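{- Let $M\subseteq\mathbb{Z}^\infty_{\ge0}$ be a $\mathrm{Sym}$-invariant normal monoid and let $\overline{M}_n=M\cap\mathbb{Z}^n$ for $n\ge1$, forming the chain $\overline{\mathcal{M}}=(\overline{M}_n)_{n\ge1}$. The following are equivalent: (i) $M$ is $\mathrm{Sym}$-equivariantly $\widehat{\mathrm{mn}}$-finitely generated; (ii) $\overline{\mathcal{M}}$ $\widehat{\mathrm{mn}}$-stabilizes and $\overline{M}_n$ is $\widehat{\mathrm{mn}}$-finitely generated for all $n\ge1$; (iii) there exists $s\in\mathbb{N}$ such that for all $n\ge1$, $\overline{M}_n=\widehat{\mathrm{mn}}(A_n)$ for some finite set $A_n$ of elements of support size at most $s$.
   Context: $\mathbb{Z}^\infty_{\ge0}$ is the set of nonnegative integer sequences with finitely many nonzero entries; $\mathbb{Z}^n$ is identified with sequences vanishing after position $n$. $\mathrm{Sym}$ (finitary permutations of $\mathbb{N}$) and $\mathrm{Sym}(n)$ act by $\sigma(u)_i=u_{\sigma^{ -1}(i)}$; $\mathrm{Sym}(A)$, $\mathrm{Sym}(n)(A)$ denote orbit sets. $\mathrm{mn}(A)$ is the set of nonnegative integer combinations of elements of $A$; $\widehat{\mathrm{mn}}(A)=\{u: ku\in\mathrm{mn}(A)\text{ for some } k\in\mathbb{N}\}$ is its normalization; a monoid $N$ is normal if $N$ equals its normalization. A normal monoid is $\widehat{\mathrm{mn}}$-finitely generated if it equals $\widehat{\mathrm{mn}}(A)$ for finite $A$, and $\mathrm{Sym}$-equivariantly $\widehat{\mathrm{mn}}$-finitely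 generated if it equals $\widehat{\mathrm{mn}}(\mathrm{Sym}(A))$ for finite $A$. A chain of normal monoids $(M_n)$, $M_n\subseteq\mathbb{Z}^n$, $\widehat{\mathrm{mn}}$-stabilizes if $M_n=\widehat{\mathrm{mn}}(\mathrm{Sym}(n)(M_m))$ for all $n\ge m\gg0$. Support size of $u$ is $|\{i:u_i\ne0\}|$. -}

module Defs where

open import Data.Nat using (ℕ; zero; suc; _+_; _*_; _≤_)
open import Data.List using (List; length)
open import Data.List.Membership.Propositional using (_∈_)
open import Data.Product using (Σ; ∃; _×_; _,_)
open import Relation.Binary.PropositionalEquality using (_≡_; _≢_)
open import Function.Bundles using (_⇔_)

-- Elements of ℤ^∞ with nonnegative entries: sequences ℕ → ℕ (0-indexed).
Seq : Set
Seq = ℕ → ℕ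

SeqSet : Set₁
SeqSet = Seq → Set

_≐_ : SeqSet → SeqSet → Set
A ≐ B = ∀ u → A u ⇔ B u

-- "u ∈ ℤ^n": u vanishes from position n on (positions 0..n-1 are the n coordinates).
InZ : ℕ → Seq → Set
InZ n u = ∀ i → n ≤ i → u i ≡ 0

FinSupp : Seq → Set
FinSupp u = ∃ λ N → InZ N u

SuppSize≤ : ℕ → Seq → Set
SuppSize≤ s u = Σ (List ℕ) λ S → length S ≤ s × (∀ i → u i ≢ 0 → i ∈ S)

record Perm (bound : ℕ) : Set where
  field
    fun : ℕ → ℕ
    inv : ℕ → ℕ
    inv-fun : ∀ i → inv (fun i) ≡ i
    fun-inv : ∀ i → fun (inv i) ≡ i
    fixes : ∀ i → bound ≤ i → fun i ≡ i

act : ∀ {b} → Perm b → Seq → Seq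
act σ u i = u (Perm.inv σ i)

SymOrb : SeqSet → SeqSet
SymOrb A u = Σ ℕ λ b → Σ (Perm b) λ σ → Σ Seq λ a → A a × (∀ i → u i ≡ act σ a i)

SymnOrb : ℕ → SeqSet → SeqSet
SymnOrb n A u = Σ (Perm n) λ σ → Σ Seq λ a → A a × (∀ i → u i ≡ act σ a i)

⟦_⟧ : List Seq → SeqSet
⟦ A ⟧ a = a ∈ A

data Mn (A : SeqSet) : Seq → Set where
  mn-zero : ∀ {u} → (∀ i → u i ≡ 0) → Mn A u
  mn-step : ∀ {u a v} → A a → Mn A v → (∀ i → u i ≡ a i + v i) → Mn A u

-- normalization: u with k·u ∈ mn(A) for some k ∈ ℕ = {1,2,...}
MnHat : SeqSet → SeqSet
MnHat A u = ∃ λ k → Mn A (λ i → suc k * u i)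

record IsNormalMonoid (M : SeqSet) : Set where
  field
    resp    : ∀ {u v} → (∀ i → u i ≡ v i) → M u → M v
    finSupp : ∀ {u} → M u → FinSupp u
    zero∈   : M (λ _ → 0)
    plus∈   : ∀ {u v} → M u → M v → M (λ i → u i + v i)
    normal  : M ≐ MnHat M

SymInvariant : SeqSet → Set
SymInvariant M = ∀ {b} (σ : Perm b) {u} → M u → M (act σ u)

MnHatFG : SeqSet → Set
MnHatFG N = Σ (List Seq) λ A → N ≐ MnHat ⟦ A ⟧

SymMnHatFG : SeqSet → Set
SymMnHatFG N = Σ (List Seq) λ A → N ≐ MnHat (SymOrb ⟦ A ⟧)

Trunc : SeqSet → ℕ → SeqSet
Trunc M n u = M u × InZ n u

MnHatStabilizes : (ℕ → SeqSet) → Set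
MnHatStabilizes C = ∃ λ r → ∀ m n → 1 ≤ m → r ≤ m → m ≤ n → C n ≐ MnHat (SymnOrb n (C m))

-- If M = mn̂(Sym(A)) with A ⊆ ℤ^B finite, an orbit element σ a lying in ℤⁿ
-- equals τ a for a product τ of exactly B transpositions of {0, …, n + B − 1}:
-- τ only has to agree with σ on the support of a.  So M ∩ ℤⁿ is generated by
-- the finitely many such τ a, each of support size at most B, and for n ≥ m ≥ B
-- these already lie in Sym(n)(M ∩ ℤ^m).  Conversely, let a finite G generate
-- M ∩ ℤ^m.  If the chain stabilises at m, or if all truncations are generated
-- by elements of support size < m (which a permutation moves into ℤ^m), then
-- every element of M lies in mn̂(Sym(G)), because normalisation is idempotent.

module Submission where

open import Defs
open import Data.Nat using (ℕ; zero; suc; _+_; _*_; _≤_; _<_; _⊔_; z≤n; s≤s; _≟_; _≤?_; _<?_)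
open import Data.Nat.Properties
open import Data.Nat.Tactic.RingSolver using (solve-∀)
open import Data.List using (List; []; _∷_; length; map; filter; upTo; cartesianProduct; cartesianProductWith; allFin)
open import Data.List.Properties using (length-map; length-upTo)
open import Data.List.Relation.Unary.All using (All; tabulate; lookup; all?)
open import Data.List.Relation.Unary.Any using (here; there)
open import Data.List.Membership.Propositional using (_∈_)
open import Data.List.Membership.Propositional.Properties
open import Data.Product using (Σ; ∃; _×_; _,_; proj₁; proj₂)
open import Data.Empty using (⊥-elim)
open import Data.Fin using (Fin; toℕ; fromℕ<)
open import Data.Fin.Properties using (toℕ<n; toℕ-fromℕ<)
open import Relation.Nullary using (Dec; yes; no; _→-dec_)
open import Relation.Binary.PropositionalEquality hiding (resp)
open import Function using (_∘_)
open import Function.Bundles using (_⇔_; mk⇔; Equivalence)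

open Perm
open Equivalence

swap : ℕ → ℕ → ℕ → ℕ
swap i j x with x ≟ i
... | yes _ = j
... | no _ with x ≟ j
...   | yes _ = i
...   | no _ = x

swap-left : ∀ i j → swap i j i ≡ j
swap-left i j with i ≟ i
... | yes _ = refl
... | no i≢i = ⊥-elim (i≢i refl)

swap-right : ∀ i j → swap i j j ≡ i
swap-right i j with j ≟ i
... | yes j≡i = j≡i
... | no _ with j ≟ j
...   | yes _ = refl
...   | no j≢j = ⊥-elim (j≢j refl)

swap-other : ∀ {i j x} → x ≢ i → x ≢ j → swap i j x ≡ x
swap-other {i} {j} {x} x≢i x≢j with x ≟ i
... | yes x≡i = ⊥-elim (x≢i x≡i)
... | no _ with x ≟ j
...   | yes x≡j = ⊥-elim (x≢j x≡j)
...   | no _ = refl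

swap-self : ∀ i x → swap i i x ≡ x
swap-self i x with x ≟ i
... | yes x≡i = sym x≡i
... | no _ with x ≟ i
...   | yes x≡i = sym x≡i
...   | no _ = refl

swap-involutive : ∀ i j x → swap i j (swap i j x) ≡ x
swap-involutive i j x = by-cases (x ≟ i) (x ≟ j)
  where
  by-cases : Dec (x ≡ i) → Dec (x ≡ j) → swap i j (swap i j x) ≡ x
  by-cases (yes refl) _ = trans (cong (swap x j) (swap-left x j)) (swap-right x j)
  by-cases (no _) (yes refl) = trans (cong (swap i x) (swap-right i x)) (swap-left i x)
  by-cases (no x≢i) (no x≢j) = trans (cong (swap i j) (swap-other x≢i x≢j)) (swap-other x≢i x≢j)

idPerm : ∀ {b} → Perm b
idPerm = record
  { fun = λ i → i ; inv = λ i → i ; inv-fun = λ _ → refl ; fun-inv = λ _ → refl ; fixes = λ _ _ → refl }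

<⇒≢-above : ∀ {i b x} → i < b → b ≤ x → x ≢ i
<⇒≢-above i<b b≤x refl = <⇒≱ i<b b≤x

swapPerm : ∀ {b} i j → i < b → j < b → Perm b
swapPerm i j i<b j<b = record
  { fun = swap i j ; inv = swap i j ; inv-fun = swap-involutive i j ; fun-inv = swap-involutive i j
  ; fixes = λ x b≤x → swap-other (<⇒≢-above i<b b≤x) (<⇒≢-above j<b b≤x) }

composePerm : ∀ {b c d} → Perm b → Perm c → b ≤ d → c ≤ d → Perm d
composePerm σ τ b≤d c≤d = record
  { fun = fun σ ∘ fun τ
  ; inv = inv τ ∘ inv σ
  ; inv-fun = λ x → trans (cong (inv τ) (inv-fun σ (fun τ x))) (inv-fun τ x)
  ; fun-inv = λ x → trans (cong (fun σ) (fun-inv τ (inv σ x))) (fun-inv σ x)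
  ; fixes = λ x d≤x → trans (cong (fun σ) (fixes τ x (≤-trans c≤d d≤x))) (fixes σ x (≤-trans b≤d d≤x)) }

inv-fixes : ∀ {b} (σ : Perm b) x → b ≤ x → inv σ x ≡ x
inv-fixes σ x b≤x = trans (cong (inv σ) (sym (fixes σ x b≤x))) (inv-fun σ x)

invPerm : ∀ {b} → Perm b → Perm b
invPerm σ = record { fun = inv σ ; inv = fun σ ; inv-fun = fun-inv σ ; fun-inv = inv-fun σ ; fixes = inv-fixes σ }

fun-injective : ∀ {b} (σ : Perm b) {x y} → fun σ x ≡ fun σ y → x ≡ y
fun-injective σ {x} {y} eq = trans (sym (inv-fun σ x)) (trans (cong (inv σ) eq) (inv-fun σ y))

fun-< : ∀ {b} (σ : Perm b) {x} → x < b → fun σ x < b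
fun-< {b} σ {x} x<b with fun σ x <? b
... | yes σx<b = σx<b
... | no σx≮b = ⊥-elim (<⇒≢-above x<b (≮⇒≥ σx≮b) (fun-injective σ (fixes σ (fun σ x) (≮⇒≥ σx≮b))))

act-inv-act : ∀ {b} (σ : Perm b) u → act (invPerm σ) (act σ u) ≗ u
act-inv-act σ u i = cong u (inv-fun σ i)

InZ-mono : ∀ {m n u} → m ≤ n → InZ m u → InZ n u
InZ-mono m≤n u∈ i n≤i = u∈ i (≤-trans m≤n n≤i)

InZ-act : ∀ {b N} (σ : Perm b) {a} → b ≤ N → InZ N a → InZ N (act σ a)
InZ-act σ {a} b≤N a∈ i N≤i = trans (cong a (inv-fixes σ i (≤-trans b≤N N≤i))) (a∈ i N≤i)

InZ-nonzero⇒< : ∀ {B a x} → InZ B a → a x ≢ 0 → x < B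
InZ-nonzero⇒< {B} {a} {x} a∈ ax≢0 with B ≤? x
... | yes B≤x = ⊥-elim (ax≢0 (a∈ x B≤x))
... | no B≰x = ≰⇒> B≰x

InZ-*ˡ : ∀ {n k u} → InZ n (λ i → suc k * u i) → InZ n u
InZ-*ˡ {u = u} ku∈ i n≤i = m+n≡0⇒m≡0 (u i) (ku∈ i n≤i)

InZ-list : (A : List Seq) → (∀ {a} → a ∈ A → FinSupp a) → Σ ℕ λ B → ∀ {a} → a ∈ A → InZ B a
InZ-list [] _ = 0 , λ ()
InZ-list (a ∷ A) finite with finite (here refl) | InZ-list A (finite ∘ there)
... | N , a∈ | B , A⊆ = N ⊔ B , λ
  { (here refl) → InZ-mono (m≤m⊔n N B) a∈
  ; (there p) → InZ-mono (m≤n⊔m N B) (A⊆ p) }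

SuppSize≤-act : ∀ {b B} (τ : Perm b) {a} → InZ B a → SuppSize≤ B (act τ a)
SuppSize≤-act {B = B} τ {a} a∈ =
  map (fun τ) (upTo B) , ≤-reflexive (trans (length-map (fun τ) (upTo B)) (length-upTo B)) , covers
  where
  covers : ∀ i → act τ a i ≢ 0 → i ∈ map (fun τ) (upTo B)
  covers i nz = subst (_∈ map (fun τ) (upTo B)) (fun-inv τ i) (∈-map⁺ (fun τ) (∈-upTo⁺ (InZ-nonzero⇒< a∈ nz)))

module _ {X : SeqSet} where

  Mn-resp : ∀ {u v} → u ≗ v → Mn X u → Mn X v
  Mn-resp u≗v (mn-zero u≗0) = mn-zero (λ i → trans (sym (u≗v i)) (u≗0 i))
  Mn-resp u≗v (mn-step a∈ m u≗a+w) = mn-step a∈ m (λ i → trans (sym (u≗v i)) (u≗a+w i))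

  Mn-+ : ∀ {u v} → Mn X u → Mn X v → Mn X (λ i → u i + v i)
  Mn-+ {v = v} (mn-zero u≗0) n = Mn-resp (λ i → sym (cong (_+ v i) (u≗0 i))) n
  Mn-+ {v = v} (mn-step {a = a} {v = w} a∈ m u≗a+w) n =
    mn-step a∈ (Mn-+ m n) (λ i → trans (cong (_+ v i) (u≗a+w i)) (+-assoc (a i) (w i) (v i)))

  Mn-* : ∀ c {u} → Mn X u → Mn X (λ i → c * u i)
  Mn-* zero m = mn-zero (λ _ → refl)
  Mn-* (suc c) m = Mn-+ m (Mn-* c m)

  Mn-singleton : ∀ {a} → X a → Mn X a
  Mn-singleton {a} a∈ = mn-step a∈ (mn-zero (λ _ → refl)) (λ i → sym (+-identityʳ (a i)))

  Mn-restrict : ∀ {n u} → Mn X u → InZ n u → Mn (λ a → X a × InZ n a) u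
  Mn-restrict (mn-zero u≗0) _ = mn-zero u≗0
  Mn-restrict (mn-step {a = a} a∈ m u≗a+w) u∈ =
    mn-step (a∈ , λ i n≤i → m+n≡0⇒m≡0 (a i) (trans (sym (u≗a+w i)) (u∈ i n≤i)))
            (Mn-restrict m (λ i n≤i → m+n≡0⇒n≡0 (a i) (trans (sym (u≗a+w i)) (u∈ i n≤i))))
            u≗a+w

  MnHat-resp : ∀ {u v} → u ≗ v → MnHat X u → MnHat X v
  MnHat-resp u≗v (k , m) = k , Mn-resp (λ i → cong (suc k *_) (u≗v i)) m

  MnHat-singleton : ∀ {a} → X a → MnHat X a
  MnHat-singleton {a} a∈ = 0 , Mn-resp (λ i → sym (+-identityʳ (a i))) (Mn-singleton a∈)

  MnHat-restrict : ∀ {n u} → MnHat X u → InZ n u → MnHat (λ a → X a × InZ n a) u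
  MnHat-restrict {u = u} (k , m) u∈ =
    k , Mn-restrict m (λ i n≤i → trans (cong (suc k *_) (u∈ i n≤i)) (*-zeroʳ (suc k)))

module _ {X Y : SeqSet} where

  Mn-map : ∀ {u} → (∀ {a} → X a → Y a) → Mn X u → Mn Y u
  Mn-map f (mn-zero u≗0) = mn-zero u≗0
  Mn-map f (mn-step a∈ m u≗a+w) = mn-step (f a∈) (Mn-map f m) u≗a+w

  Mn-map-≗ : ∀ {u} → (∀ {a} → X a → Σ Seq λ b → Y b × a ≗ b) → Mn X u → Mn Y u
  Mn-map-≗ f (mn-zero u≗0) = mn-zero u≗0
  Mn-map-≗ f (mn-step a∈ m u≗a+w) with f a∈
  ... | b , b∈ , a≗b = mn-step b∈ (Mn-map-≗ f m) (λ i → trans (u≗a+w i) (cong (_+ _) (a≗b i)))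

  MnHat-map : ∀ {u} → (∀ {a} → X a → Y a) → MnHat X u → MnHat Y u
  MnHat-map f (k , m) = k , Mn-map f m

  MnHat-map-≗ : ∀ {u} → (∀ {a} → X a → Σ Seq λ b → Y b × a ≗ b) → MnHat X u → MnHat Y u
  MnHat-map-≗ f (k , m) = k , Mn-map-≗ f m

  -- If k·a and l·w lie in mn(Y), then so does (k l)(a + w) = l(k a) + k(l w).
  Mn-bind : ∀ {u} → (∀ {a} → X a → MnHat Y a) → Mn X u → MnHat Y u
  Mn-bind f (mn-zero u≗0) = 0 , mn-zero (λ i → trans (+-identityʳ _) (u≗0 i))
  Mn-bind f (mn-step {a = a} {v = w} a∈ m u≗a+w) with f a∈ | Mn-bind f m
  ... | k , ka∈ | l , lw∈ = l + k * suc l ,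
    Mn-resp (λ i → trans (sym (distrib (suc k) (suc l) (a i) (w i))) (cong (suc k * suc l *_) (sym (u≗a+w i))))
            (Mn-+ (Mn-* (suc l) ka∈) (Mn-* (suc k) lw∈))
    where
    distrib : ∀ p q x y → p * q * (x + y) ≡ q * (p * x) + p * (q * y)
    distrib = solve-∀

  MnHat-bind : ∀ {u} → (∀ {a} → X a → MnHat Y a) → MnHat X u → MnHat Y u
  MnHat-bind {u} f (k , m) with Mn-bind f m
  ... | j , m' = k + j * suc k , Mn-resp (λ i → sym (*-assoc (suc j) (suc k) (u i))) m'

InZ-Mn : ∀ {X : SeqSet} {n u} → (∀ {a} → X a → InZ n a) → Mn X u → InZ n u
InZ-Mn X⊆ (mn-zero u≗0) i _ = u≗0 i
InZ-Mn X⊆ (mn-step a∈ m u≗a+w) i n≤i = trans (u≗a+w i) (cong₂ _+_ (X⊆ a∈ i n≤i) (InZ-Mn X⊆ m i n≤i))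

module _ {M : SeqSet} (NM : IsNormalMonoid M) where
  open IsNormalMonoid NM

  MnHat⊆ : ∀ {X : SeqSet} {u} → (∀ {a} → X a → M a) → MnHat X u → M u
  MnHat⊆ {u = u} X⊆M (k , m) = from (normal u) (k , Mn-map X⊆M m)

  MnHat⊆Trunc : ∀ {X : SeqSet} {n u} → (∀ {a} → X a → Trunc M n a) → MnHat X u → Trunc M n u
  MnHat⊆Trunc X⊆ u∈@(k , m) = MnHat⊆ (proj₁ ∘ X⊆) u∈ , InZ-*ˡ {k = k} (InZ-Mn (proj₂ ∘ X⊆) m)

module _ {G : SeqSet} where

  SymOrb-self : ∀ {a} → G a → SymOrb G a
  SymOrb-self {a} a∈ = 0 , idPerm , a , a∈ , λ _ → refl

  Mn-act : ∀ {b} (σ : Perm b) {u} → Mn (SymOrb G) u → Mn (SymOrb G) (act σ u)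
  Mn-act σ (mn-zero u≗0) = mn-zero (u≗0 ∘ inv σ)
  Mn-act {b} σ (mn-step (c , τ , g , g∈ , a≗τg) m u≗a+w) =
    mn-step (b ⊔ c , composePerm σ τ (m≤m⊔n b c) (m≤n⊔m b c) , g , g∈ , a≗τg ∘ inv σ)
            (Mn-act σ m) (u≗a+w ∘ inv σ)

  MnHat-act : ∀ {b} (σ : Perm b) {u} → MnHat (SymOrb G) u → MnHat (SymOrb G) (act σ u)
  MnHat-act σ (k , m) = k , Mn-act σ m

  MnHat-unact : ∀ {b} (σ : Perm b) {u} → MnHat (SymOrb G) (act σ u) → MnHat (SymOrb G) u
  MnHat-unact σ {u} σu∈ = MnHat-resp (act-inv-act σ u) (MnHat-act (invPerm σ) σu∈)

  SymnOrb-MnHat : ∀ {X : SeqSet} {n x} → (∀ {a} → X a → MnHat (SymOrb G) a) →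
    SymnOrb n X x → MnHat (SymOrb G) x
  SymnOrb-MnHat X⊆ (ρ , a , a∈ , x≗ρa) = MnHat-resp (sym ∘ x≗ρa) (MnHat-act ρ (X⊆ a∈))

inv-agree : ∀ {b c} (τ : Perm c) (σ : Perm b) (a : Seq) → (∀ x → a x ≢ 0 → fun τ x ≡ fun σ x) →
  ∀ {i} → a (inv τ i) ≢ 0 → inv σ i ≡ inv τ i
inv-agree τ σ a τ≈σ {i} nz = trans (cong (inv σ) (sym (trans (sym (τ≈σ _ nz)) (fun-inv τ i)))) (inv-fun σ (inv τ i))

act-agree : ∀ {b c} (τ : Perm c) (σ : Perm b) (a : Seq) →
  (∀ x → a x ≢ 0 → fun τ x ≡ fun σ x) → act τ a ≗ act σ a
act-agree τ σ a τ≈σ i with a (inv τ i) ≟ 0 | a (inv σ i) ≟ 0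
... | no τ⁻¹i∈ | _ = cong a (sym (inv-agree τ σ a τ≈σ τ⁻¹i∈))
... | yes _ | no σ⁻¹i∈ = cong a (inv-agree σ τ a (λ x nz → sym (τ≈σ x nz)) σ⁻¹i∈)
... | yes τ⁻¹i≡0 | yes σ⁻¹i≡0 = trans τ⁻¹i≡0 (sym σ⁻¹i≡0)

Word : ℕ → Set
Word N = List (Fin N × Fin N)

wordPerm : ∀ {N} → Word N → Perm N
wordPerm [] = idPerm
wordPerm ((i , j) ∷ w) = composePerm (swapPerm (toℕ i) (toℕ j) (toℕ<n i) (toℕ<n j)) (wordPerm w) ≤-refl ≤-refl

wordPerm-∷ : ∀ {N i j} (i<N : i < N) (j<N : j < N) w x →
  fun (wordPerm ((fromℕ< i<N , fromℕ< j<N) ∷ w)) x ≡ swap i j (fun (wordPerm w) x)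
wordPerm-∷ i<N j<N w x = cong₂ (λ i j → swap i j (fun (wordPerm w) x)) (toℕ-fromℕ< i<N) (toℕ-fromℕ< j<N)

words : ∀ N → ℕ → List (Word N)
words N zero = [] ∷ []
words N (suc k) = cartesianProductWith _∷_ (cartesianProduct (allFin N) (allFin N)) (words N k)

∈-words : ∀ {N} (w : Word N) → w ∈ words N (length w)
∈-words [] = here refl
∈-words ((i , j) ∷ w) =
  ∈-cartesianProductWith⁺ _∷_ (∈-cartesianProduct⁺ (∈-allFin i) (∈-allFin j)) (∈-words w)

-- Positions outside the support are padded with the trivial letter (k , k),
-- so that the word length is exactly k.
realise-prefix : ∀ {N b} (σ : Perm b) (a : Seq) → (∀ x → a x ≢ 0 → fun σ x < N) →
  ∀ k → k ≤ N → Σ (Word N) λ w → length w ≡ k × (∀ x → x < k → a x ≢ 0 → fun (wordPerm w) x ≡ fun σ x)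
realise-prefix σ a σ<N zero _ = [] , refl , λ _ ()
realise-prefix σ a σ<N (suc k) k<N with realise-prefix σ a σ<N k (<⇒≤ k<N) | a k ≟ 0
... | w , |w|≡k , τ≈σ | yes ak≡0 = (fromℕ< k<N , fromℕ< k<N) ∷ w , cong suc |w|≡k , τ'≈σ
  where
  τ'≈σ : ∀ x → x < suc k → a x ≢ 0 → fun (wordPerm ((fromℕ< k<N , fromℕ< k<N) ∷ w)) x ≡ fun σ x
  τ'≈σ x x<1+k ax≢0 = begin
    fun (wordPerm ((fromℕ< k<N , fromℕ< k<N) ∷ w)) x ≡⟨ wordPerm-∷ k<N k<N w x ⟩
    swap k k (fun (wordPerm w) x)                     ≡⟨ swap-self k _ ⟩
    fun (wordPerm w) x                                ≡⟨ τ≈σ x (≤∧≢⇒< (≤-pred x<1+k) λ { refl → ax≢0 ak≡0 }) ax≢0 ⟩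
    fun σ x                                           ∎
    where open ≡-Reasoning
... | w , |w|≡k , τ≈σ | no ak≢0 = (fromℕ< τk<N , fromℕ< σk<N) ∷ w , cong suc |w|≡k , τ'≈σ
  where
  τ = wordPerm w
  τk<N = fun-< τ k<N
  σk<N = σ<N k ak≢0
  swap-τ≈σ : ∀ x → x < suc k → a x ≢ 0 → swap (fun τ k) (fun σ k) (fun τ x) ≡ fun σ x
  swap-τ≈σ x x<1+k ax≢0 with x ≟ k
  ... | yes refl = swap-left (fun τ k) (fun σ k)
  ... | no x≢k = trans (cong (swap _ _) τx≡σx)
                       (swap-other (x≢k ∘ fun-injective τ ∘ trans τx≡σx) (x≢k ∘ fun-injective σ))
    where
    τx≡σx = τ≈σ x (≤∧≢⇒< (≤-pred x<1+k) x≢k) ax≢0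
  τ'≈σ : ∀ x → x < suc k → a x ≢ 0 → fun (wordPerm ((fromℕ< τk<N , fromℕ< σk<N) ∷ w)) x ≡ fun σ x
  τ'≈σ x x<1+k ax≢0 = trans (wordPerm-∷ τk<N σk<N w x) (swap-τ≈σ x x<1+k ax≢0)

realise : ∀ {N b B n} (σ : Perm b) {a} → InZ B a → InZ n (act σ a) → B ≤ N → n ≤ N →
  Σ (Word N) λ w → length w ≡ B × act (wordPerm w) a ≗ act σ a
realise {B = B} σ {a} a∈ σa∈ B≤N n≤N with realise-prefix σ a σ<N B B≤N
  where
  σ<N : ∀ x → a x ≢ 0 → fun σ x < _
  σ<N x ax≢0 = <-≤-trans (InZ-nonzero⇒< σa∈ (ax≢0 ∘ trans (cong a (sym (inv-fun σ x))))) n≤N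
... | w , |w|≡B , τ≈σ =
  w , |w|≡B , act-agree (wordPerm w) σ a (λ x ax≢0 → τ≈σ x (InZ-nonzero⇒< a∈ ax≢0) ax≢0)

-- If ρ already sends x below t + 1 nothing changes; otherwise the slot t is
-- free (ρ sends S below t), so ρ x is swapped into it.
gather : (S : List ℕ) (t : ℕ) → length S ≤ t → Σ ℕ λ b → Σ (Perm b) λ ρ → ∀ {x} → x ∈ S → fun ρ x < t
gather [] t _ = 0 , idPerm , λ ()
gather (x ∷ S) (suc t) (s≤s |S|≤t) with gather S t |S|≤t
... | b , ρ , ρS<t with fun ρ x <? suc t
...   | yes ρx<1+t = b , ρ , λ { (here refl) → ρx<1+t ; (there p) → m<n⇒m<1+n (ρS<t p) }
...   | no ρx≮1+t = c ⊔ b , composePerm (swapPerm y t y<c t<c) ρ (m≤m⊔n c b) (m≤n⊔m c b) , swapρ<1+t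
  where
  y = fun ρ x
  c = suc (y ⊔ t)
  y<c : y < c
  y<c = s≤s (m≤m⊔n y t)
  t<c : t < c
  t<c = s≤s (m≤n⊔m y t)
  swapρ<1+t : ∀ {z} → z ∈ x ∷ S → swap y t (fun ρ z) < suc t
  swapρ<1+t (here refl) = subst (_< suc t) (sym (swap-left y t)) ≤-refl
  swapρ<1+t {z} (there p) = subst (_< suc t) (sym (swap-other ρz≢y ρz≢t)) (m<n⇒m<1+n (ρS<t p))
    where
    ρz≢y : fun ρ z ≢ y
    ρz≢y ρz≡y = ρx≮1+t (m<n⇒m<1+n (subst (_< t) ρz≡y (ρS<t p)))
    ρz≢t : fun ρ z ≢ t
    ρz≢t ρz≡t = <-irrefl ρz≡t (ρS<t p)

gather-support : ∀ {s a} → SuppSize≤ s a → Σ ℕ λ b → Σ (Perm b) λ ρ → InZ s (act ρ a)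
gather-support {s} {a} (S , |S|≤s , supp⊆S) with gather S s |S|≤s
... | b , ρ , ρS<s = b , ρ , ρa∈
  where
  ρa∈ : InZ s (act ρ a)
  ρa∈ i s≤i with a (inv ρ i) ≟ 0
  ... | yes a≡0 = a≡0
  ... | no a≢0 = ⊥-elim (<⇒≱ (subst (_< s) (fun-inv ρ i) (ρS<s (supp⊆S (inv ρ i) a≢0))) s≤i)

VanishesBetween : ℕ → ℕ → Seq → Set
VanishesBetween n N u = All (λ i → n ≤ i → u i ≡ 0) (upTo N)

vanishesBetween? : ∀ n N u → Dec (VanishesBetween n N u)
vanishesBetween? n N u = all? (λ i → n ≤? i →-dec u i ≟ 0) (upTo N)

InZ⇒VanishesBetween : ∀ {n N u} → InZ n u → VanishesBetween n N u
InZ⇒VanishesBetween u∈ = tabulate (λ {i} _ → u∈ i)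

VanishesBetween⇒InZ : ∀ {n N u} → InZ N u → VanishesBetween n N u → InZ n u
VanishesBetween⇒InZ {N = N} u∈ u∈ⁿ i n≤i with i <? N
... | yes i<N = lookup u∈ⁿ (∈-upTo⁺ i<N) n≤i
... | no i≮N = u∈ i (≮⇒≥ i≮N)

GeneratedBySupport≤ : ℕ → SeqSet → Set
GeneratedBySupport≤ s N = Σ (List Seq) λ A → All (SuppSize≤ s) A × (N ≐ MnHat ⟦ A ⟧)

module _ {M : SeqSet} (NM : IsNormalMonoid M) (SI : SymInvariant M) where
  open IsNormalMonoid NM

  SymOrb⊆ : ∀ {G : SeqSet} {x} → (∀ {g} → G g → M g) → SymOrb G x → M x
  SymOrb⊆ G⊆M (_ , σ , _ , g∈ , x≗σg) = resp (sym ∘ x≗σg) (SI σ (G⊆M g∈))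

  generator∈Trunc : ∀ {n G g} → Trunc M n ≐ MnHat ⟦ G ⟧ → g ∈ G → Trunc M n g
  generator∈Trunc {g = g} Mₙ≐ g∈ = from (Mₙ≐ g) (MnHat-singleton g∈)

  Trunc⇒MnHat-SymOrb : ∀ {n G a} → Trunc M n ≐ MnHat ⟦ G ⟧ → Trunc M n a → MnHat (SymOrb ⟦ G ⟧) a
  Trunc⇒MnHat-SymOrb {a = a} Mₙ≐ a∈ = MnHat-map SymOrb-self (to (Mₙ≐ a) a∈)

  Trunc-eventually : ∀ {u} → M u → ∀ m → Σ ℕ λ N → m ≤ N × Trunc M N u
  Trunc-eventually u∈ m with finSupp u∈
  ... | N , u∈ᴺ = N + m , m≤n+m m N , u∈ , InZ-mono (m≤m+n N m) u∈ᴺ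

  SymMnHatFG-intro : (G : List Seq) → (∀ {g} → g ∈ G → M g) →
    (∀ {u} → M u → MnHat (SymOrb ⟦ G ⟧) u) → SymMnHatFG M
  SymMnHatFG-intro G G⊆M M⊆ = G , λ u → mk⇔ M⊆ (MnHat⊆ NM (SymOrb⊆ G⊆M))

  stabilizes⇒SymMnHatFG : MnHatStabilizes (Trunc M) → (∀ n → 1 ≤ n → MnHatFG (Trunc M n)) → SymMnHatFG M
  stabilizes⇒SymMnHatFG (r , stable) generated with generated (suc r) (s≤s z≤n)
  ... | G , Mᵣ≐ = SymMnHatFG-intro G (proj₁ ∘ generator∈Trunc Mᵣ≐) M⊆
    where
    M⊆ : ∀ {u} → M u → MnHat (SymOrb ⟦ G ⟧) u
    M⊆ {u} u∈ with Trunc-eventually u∈ (suc r)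
    ... | N , 1+r≤N , u∈ᴺ = MnHat-bind (SymnOrb-MnHat (Trunc⇒MnHat-SymOrb Mᵣ≐))
                                       (to (stable (suc r) N (s≤s z≤n) (n≤1+n r) 1+r≤N u) u∈ᴺ)

  boundedSupport⇒SymMnHatFG : (∃ λ s → ∀ n → 1 ≤ n → GeneratedBySupport≤ s (Trunc M n)) → SymMnHatFG M
  boundedSupport⇒SymMnHatFG (s , generated) with generated (suc s) (s≤s z≤n)
  ... | G , _ , Mₛ≐ = SymMnHatFG-intro G (proj₁ ∘ generator∈Trunc Mₛ≐) M⊆
    where
    small⇒MnHat-SymOrb : ∀ {n A a} → Trunc M n ≐ MnHat ⟦ A ⟧ → SuppSize≤ s a → a ∈ A → MnHat (SymOrb ⟦ G ⟧) a
    small⇒MnHat-SymOrb Mₙ≐ a-small a∈ with gather-support a-small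
    ... | _ , ρ , ρa∈ = MnHat-unact ρ (Trunc⇒MnHat-SymOrb Mₛ≐
                          (SI ρ (proj₁ (generator∈Trunc Mₙ≐ a∈)) , InZ-mono (n≤1+n s) ρa∈))
    M⊆ : ∀ {u} → M u → MnHat (SymOrb ⟦ G ⟧) u
    M⊆ {u} u∈ with Trunc-eventually u∈ 1
    ... | N , 1≤N , u∈ᴺ with generated N 1≤N
    ...   | A , A-small , Mₙ≐ =
      MnHat-bind (λ a∈ → small⇒MnHat-SymOrb Mₙ≐ (lookup A-small a∈) a∈) (to (Mₙ≐ u) u∈ᴺ)

  module FromSymMnHatFG (A : List Seq) (M≐ : M ≐ MnHat (SymOrb ⟦ A ⟧)) where

    A⊆M : ∀ {a} → a ∈ A → M a
    A⊆M {a} a∈ = from (M≐ a) (MnHat-singleton (SymOrb-self a∈))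

    B : ℕ
    B = proj₁ (InZ-list A (finSupp ∘ A⊆M))

    A⊆ℤᴮ : ∀ {a} → a ∈ A → InZ B a
    A⊆ℤᴮ = proj₂ (InZ-list A (finSupp ∘ A⊆M))

    orbit-as-word : ∀ {n N x} → B ≤ N → n ≤ N → SymOrb ⟦ A ⟧ x → InZ n x →
      Σ Seq λ g → g ∈ A × Σ (Word N) λ w → length w ≡ B × x ≗ act (wordPerm w) g
    orbit-as-word B≤N n≤N (_ , σ , g , g∈ , x≗σg) x∈ with realise σ (A⊆ℤᴮ g∈) σg∈ B≤N n≤N
      where
      σg∈ = λ i n≤i → trans (sym (x≗σg i)) (x∈ i n≤i)
    ... | w , |w|≡B , τg≗σg = g , g∈ , w , |w|≡B , λ i → trans (x≗σg i) (sym (τg≗σg i))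

    Trunc⊆MnHat : ∀ {n} {Y : SeqSet} {u} → (∀ {x} → SymOrb ⟦ A ⟧ x → InZ n x → Σ Seq λ y → Y y × x ≗ y) →
      Trunc M n u → MnHat Y u
    Trunc⊆MnHat {u = u} as-Y (u∈ , u∈ⁿ) =
      MnHat-map-≗ (λ (x∈ , x∈ⁿ) → as-Y x∈ x∈ⁿ) (MnHat-restrict (to (M≐ u) u∈) u∈ⁿ)

    candidates : ℕ → List Seq
    candidates n = filter (vanishesBetween? n (n + B))
      (cartesianProductWith (λ a w → act (wordPerm w) a) A (words (n + B) B))

    ∈-candidates⁻ : ∀ {n u} → u ∈ candidates n →
      Σ Seq λ a → a ∈ A × Σ (Word (n + B)) λ w → u ≡ act (wordPerm w) a × InZ n u
    ∈-candidates⁻ {n} u∈ with ∈-filter⁻ (vanishesBetween? n (n + B)) u∈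
    ... | u∈words , u∈ⁿ with ∈-cartesianProductWith⁻ (λ a w → act (wordPerm w) a) A (words (n + B) B) u∈words
    ...   | a , w , a∈ , _ , refl =
      a , a∈ , w , refl , VanishesBetween⇒InZ (InZ-act (wordPerm w) ≤-refl (InZ-mono (m≤n+m B n) (A⊆ℤᴮ a∈))) u∈ⁿ

    ∈-candidates⁺ : ∀ {n a} {w : Word (n + B)} → a ∈ A → length w ≡ B → InZ n (act (wordPerm w) a) →
      act (wordPerm w) a ∈ candidates n
    ∈-candidates⁺ {n} {w = w} a∈ |w|≡B τa∈ = ∈-filter⁺ (vanishesBetween? n (n + B))
      (∈-cartesianProductWith⁺ (λ a w → act (wordPerm w) a) a∈
        (subst (λ k → w ∈ words (n + B) k) |w|≡B (∈-words w)))
      (InZ⇒VanishesBetween τa∈)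

    candidate∈Trunc : ∀ {n u} → u ∈ candidates n → Trunc M n u
    candidate∈Trunc u∈ with ∈-candidates⁻ u∈
    ... | _ , a∈ , w , refl , u∈ⁿ = SI (wordPerm w) (A⊆M a∈) , u∈ⁿ

    candidate-small : ∀ {n u} → u ∈ candidates n → SuppSize≤ B u
    candidate-small u∈ with ∈-candidates⁻ u∈
    ... | _ , a∈ , w , refl , _ = SuppSize≤-act (wordPerm w) (A⊆ℤᴮ a∈)

    Trunc≐candidates : ∀ n → Trunc M n ≐ MnHat ⟦ candidates n ⟧
    Trunc≐candidates n u = mk⇔ (Trunc⊆MnHat as-candidate) (MnHat⊆Trunc NM candidate∈Trunc)
      where
      as-candidate : ∀ {x} → SymOrb ⟦ A ⟧ x → InZ n x → Σ Seq λ y → y ∈ candidates n × x ≗ y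
      as-candidate x∈ x∈ⁿ with orbit-as-word (m≤n+m B n) (m≤m+n n B) x∈ x∈ⁿ
      ... | g , g∈ , w , |w|≡B , x≗τg =
        act (wordPerm w) g , ∈-candidates⁺ {w = w} g∈ |w|≡B (λ i n≤i → trans (sym (x≗τg i)) (x∈ⁿ i n≤i)) , x≗τg

    boundedSupport : ∃ λ s → ∀ n → 1 ≤ n → GeneratedBySupport≤ s (Trunc M n)
    boundedSupport = B , λ n _ → candidates n , tabulate candidate-small , Trunc≐candidates n

    generated : ∀ n → 1 ≤ n → MnHatFG (Trunc M n)
    generated n _ = candidates n , Trunc≐candidates n

    stabilizes : MnHatStabilizes (Trunc M)
    stabilizes = B , λ m n _ B≤m m≤n u → mk⇔ (Trunc⊆MnHat (as-orbit B≤m m≤n)) (MnHat⊆Trunc NM (orbit∈Trunc m≤n))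
      where
      orbit∈Trunc : ∀ {m n x} → m ≤ n → SymnOrb n (Trunc M m) x → Trunc M n x
      orbit∈Trunc m≤n (ρ , g , (g∈ , g∈ᵐ) , x≗ρg) =
        resp (sym ∘ x≗ρg) (SI ρ g∈) , λ i n≤i → trans (x≗ρg i) (InZ-act ρ ≤-refl (InZ-mono m≤n g∈ᵐ) i n≤i)
      as-orbit : ∀ {m n x} → B ≤ m → m ≤ n → SymOrb ⟦ A ⟧ x → InZ n x →
        Σ Seq λ y → SymnOrb n (Trunc M m) y × x ≗ y
      as-orbit B≤m m≤n x∈ x∈ⁿ with orbit-as-word (≤-trans B≤m m≤n) ≤-refl x∈ x∈ⁿ
      ... | g , g∈ , w , _ , x≗τg =
        act (wordPerm w) g , (wordPerm w , g , (A⊆M g∈ , InZ-mono B≤m (A⊆ℤᴮ g∈)) , λ _ → refl) , x≗τg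

lemma5p3 : (M : SeqSet) → IsNormalMonoid M → SymInvariant M →
    (SymMnHatFG M ⇔ (MnHatStabilizes (Trunc M) × (∀ n → 1 ≤ n → MnHatFG (Trunc M n))))
    × (SymMnHatFG M ⇔ (∃ λ s → ∀ n → 1 ≤ n →
    Σ (List Seq) λ A → All (SuppSize≤ s) A × (Trunc M n ≐ MnHat ⟦ A ⟧)))
lemma5p3 M NM SI =
    mk⇔ (λ (A , M≐) → let open FromSymMnHatFG NM SI A M≐ in stabilizes , generated)
        (λ (stable , generated) → stabilizes⇒SymMnHatFG NM SI stable generated)
  , mk⇔ (λ (A , M≐) → FromSymMnHatFG.boundedSupport NM SI A M≐)
        (boundedSupport⇒SymMnHatFG NM SI)
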